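{- If $d_{\max}^4=o(M)$ and $M_2(R)=O(d_{\max}^3)$, then the probability that a uniformly random restricted pairing in $\mathcal{M}(L,R,{\bf d})$ contains a loop or a double pair is $O(d_{\max}^4/M)$.
   Context: Setting: $L,R$ partition $[n]$, ${\bf d}=(d_1,\dots,d_n)$ nonnegative integers with $M=\sum_i d_i$ even, $d_{\max}=\max_i d_i$, $M_1(S)=\sum_{i\in S}d_i$, $M_2(S)=\sum_{i\in S}d_i(d_i-1)$, standing assumption $M_1(R)\ge M_1(L)$; asymptotics as $n\to\infty$ with $M\to\infty$. Pairing model: vertex $i$ is a bucket with $d_i$ points; a pairing is a perfect matching of all $M$ points; it is restricted if no pair has both points in buckets of vertices in $L$; $\mathcal{M}(L,R,{\bf d})$ is the uniformly distributed set of restricted pairings. A loop is a pair with both points in the same vertex; a double pair is a set of two pairs $\{u_1,u'_1\},\{u_2,u'_2\}$ with $u_1,u_2$ in one vertex and $u'_1,u'_2$ in another vertex. -}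

module Defs where

open import Data.Bool using (Bool; true; false; _∧_; _∨_; not)
open import Data.Nat using (ℕ; zero; suc; _+_; _*_; _∸_; _⊔_)
open import Data.Fin using (Fin)
import Data.Fin as F
open import Data.List using (List; []; _∷_; map; concatMap; allFin; filterᵇ; length; foldr; replicate; lookup)
open import Data.Nat.ListAction using (sum)
open import Data.Bool.ListAction using (all; any)
open import Data.Vec using (Vec; []; _∷_)
import Data.Vec as V
open import Relation.Nullary.Decidable using (⌊_⌋)

-- An instance of the model: n vertices, degrees d, and a membership
-- predicate inL (true = vertex in L, false = vertex in R).

M : ∀ {n} → (Fin n → ℕ) → ℕ
M {n} d = sum (map d (allFin n))

-- M_1(S) for S = L (b = true) or S = R (b = false)
M1 : ∀ {n} → (Fin n → ℕ) → (Fin n → Bool) → Bool → ℕ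
M1 {n} d inL b = sum (map (λ i → if⟨ inL i , b ⟩ (d i)) (allFin n))
  where
  if⟨_,_⟩ : Bool → Bool → ℕ → ℕ
  if⟨ true , true ⟩ x = x
  if⟨ false , false ⟩ x = x
  if⟨ _ , _ ⟩ x = 0

M2R : ∀ {n} → (Fin n → ℕ) → (Fin n → Bool) → ℕ
M2R {n} d inL = sum (map f (allFin n))
  where
  f : Fin n → ℕ
  f i with inL i
  ... | true = 0
  ... | false = d i * (d i ∸ 1)

dmax : ∀ {n} → (Fin n → ℕ) → ℕ
dmax {n} d = foldr _⊔_ 0 (map d (allFin n))

-- The points: the list of owners; vertex i contributes d i points.
points : ∀ {n} → (Fin n → ℕ) → List (Fin n)
points {n} d = concatMap (λ i → replicate (d i) i) (allFin n)

npts : ∀ {n} → (Fin n → ℕ) → ℕ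
npts d = length (points d)

owner : ∀ {n} (d : Fin n → ℕ) → Fin (npts d) → Fin n
owner d x = lookup (points d) x

allVecs : ∀ m k → List (Vec (Fin m) k)
allVecs m zero = [] ∷ []
allVecs m (suc k) = concatMap (λ x → map (x ∷_) (allVecs m k)) (allFin m)

-- A candidate pairing: a map v on points (v x = partner of x)
Cand : ∀ {n} → (Fin n → ℕ) → Set
Cand d = Vec (Fin (npts d)) (npts d)

_==_ : ∀ {m} → Fin m → Fin m → Bool
x == y = ⌊ x F.≟ y ⌋

isPairing : ∀ {n} (d : Fin n → ℕ) → Cand d → Bool
isPairing d v = all (λ x → (V.lookup v (V.lookup v x) == x) ∧ not (V.lookup v x == x)) (allFin (npts d))

isRestricted : ∀ {n} (d : Fin n → ℕ) → (Fin n → Bool) → Cand d → Bool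
isRestricted d inL v = all (λ x → not (inL (owner d x) ∧ inL (owner d (V.lookup v x)))) (allFin (npts d))

hasLoop : ∀ {n} (d : Fin n → ℕ) → Cand d → Bool
hasLoop d v = any (λ x → owner d x == owner d (V.lookup v x)) (allFin (npts d))

hasDoublePair : ∀ {n} (d : Fin n → ℕ) → Cand d → Bool
hasDoublePair d v = any (λ x → any (λ y →
     not (x == y) ∧ not (y == V.lookup v x)
   ∧ (owner d x == owner d y)
   ∧ (owner d (V.lookup v x) == owner d (V.lookup v y))
   ∧ not (owner d x == owner d (V.lookup v x)))
   (allFin (npts d))) (allFin (npts d))

nRestricted : ∀ {n} (d : Fin n → ℕ) → (Fin n → Bool) → ℕ
nRestricted d inL = length (filterᵇ (λ v → isPairing d v ∧ isRestricted d inL v) (allVecs _ _))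

nBad : ∀ {n} (d : Fin n → ℕ) → (Fin n → Bool) → ℕ
nBad d inL = length (filterᵇ (λ v → isPairing d v ∧ isRestricted d inL v ∧ (hasLoop d v ∨ hasDoublePair d v)) (allVecs _ _))

module Submission where

-- The proof is a switching argument; all counts are sums of indicators over
-- explicit lists. Then, for one fixed instance (module Pairings):
--  * a loop or double pair in a restricted pairing contains a "configuration":
--    one or two prescribed pairs whose second points lie in R (union bound);
--  * switching a prescribed pair {x, x'} against a pair {b, P b} with b ∈ R is
--    injective, so each prescribed pair costs a factor K = M₁(R) - 4;
--  * there are at most M₂(R) loop configurations and d_max·M·M₂(R) double ones.
-- Hence |bad|·K² ≤ (1 + d_max)·M·M₂(R)·|restricted|, and as M ≤ 4K once M ≥ 16,
-- |bad|·M ≤ 16 (1 + d_max) M₂(R)·|restricted|. The corollary follows from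
-- M₂(R) ≤ C d_max³ with constant 32C.

open import Level using (Level)
open import Data.Bool using (Bool; true; false; _∧_; _∨_; not; T; T?)
open import Data.Bool.Properties using (T-≡; ∧-identityʳ)
open import Function.Bundles using (Equivalence)
open import Data.Unit using (tt)
open import Data.Nat using (ℕ; zero; suc; _+_; _*_; _∸_; _^_; _≤_; _⊔_; z≤n; s≤s; NonZero; >-nonZero)
open import Data.Nat.Tactic.RingSolver using (solve-∀)
open import Data.Nat.Properties
open import Data.Nat.ListAction using (sum)
open import Data.Nat.Divisibility using (_∣_)
open import Data.Nat.ListAction.Properties using (sum-++)
open import Data.Fin using (Fin)
import Data.Fin as F
open import Data.List using (List; []; _∷_; _++_; map; concatMap; allFin; filterᵇ; length; foldr; replicate; lookup; tabulate; cartesianProduct; cartesianProductWith)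
open import Data.List.Properties using (map-++; map-∘; map-tabulate; tabulate-cong; length-map; length-++)
open import Data.Bool.ListAction using (all; any)
open import Data.List.Membership.Propositional using (_∈_)
open import Data.List.Membership.Propositional.Properties
open import Data.List.Relation.Unary.Any using (here; there)
open import Data.List.Relation.Unary.All as All using ([])
import Data.List.Relation.Unary.All.Properties as AllP
open import Data.List.Relation.Unary.AllPairs using ([]; _∷_)
open import Data.List.Relation.Unary.Unique.Propositional using (Unique)
open import Data.List.Relation.Unary.Unique.Propositional.Properties using (allFin⁺; filter⁺; cartesianProduct⁺; cartesianProductWith⁺)
open import Data.Vec using (Vec; []; _∷_)
import Data.Vec as V
import Data.Vec.Properties as VP
open import Data.Product using (Σ; _×_; _,_; proj₁; proj₂; ∃)
import Data.Product
open import Data.Sum using (_⊎_; inj₁; inj₂)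
import Data.Sum
open import Data.Empty using (⊥-elim)
open import Relation.Binary.PropositionalEquality
open import Function using (_∘_)
open import Relation.Nullary using (¬_; yes; no)
open import Relation.Nullary.Decidable using (dec-true; dec-false; isYes≗does; ⌊⌋-map′; toWitness; toWitnessFalse)
open import Algebra.Properties.CommutativeSemigroup +-commutativeSemigroup using (interchange)
open import Defs

private
  variable
    ℓ ℓ' : Level
    A : Set ℓ
    B : Set ℓ'

⟦_⟧ : Bool → ℕ
⟦ true ⟧ = 1
⟦ false ⟧ = 0

⟦⟧≤1 : ∀ x → ⟦ x ⟧ ≤ 1
⟦⟧≤1 true = ≤-refl
⟦⟧≤1 false = z≤n

⟦∧⟧ : ∀ x y → ⟦ x ∧ y ⟧ ≡ ⟦ x ⟧ * ⟦ y ⟧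
⟦∧⟧ true y = sym (+-identityʳ ⟦ y ⟧)
⟦∧⟧ false y = refl

Σl : (A → ℕ) → List A → ℕ
Σl f xs = sum (map f xs)

length-filterᵇ : ∀ (p : A → Bool) xs → length (filterᵇ p xs) ≡ Σl (λ x → ⟦ p x ⟧) xs
length-filterᵇ p [] = refl
length-filterᵇ p (x ∷ xs) with p x
... | true = cong suc (length-filterᵇ p xs)
... | false = length-filterᵇ p xs

Σl-mono : ∀ {f g : A → ℕ} xs → (∀ x → f x ≤ g x) → Σl f xs ≤ Σl g xs
Σl-mono [] f≤g = z≤n
Σl-mono (x ∷ xs) f≤g = +-mono-≤ (f≤g x) (Σl-mono xs f≤g)

Σl-cong : ∀ {f g : A → ℕ} xs → (∀ x → f x ≡ g x) → Σl f xs ≡ Σl g xs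
Σl-cong [] f≡g = refl
Σl-cong (x ∷ xs) f≡g = cong₂ _+_ (f≡g x) (Σl-cong xs f≡g)

Σl-+ : ∀ (f g : A → ℕ) xs → Σl (λ x → f x + g x) xs ≡ Σl f xs + Σl g xs
Σl-+ f g [] = refl
Σl-+ f g (x ∷ xs) = trans (cong (f x + g x +_) (Σl-+ f g xs)) (interchange (f x) (g x) (Σl f xs) (Σl g xs))

Σl-*ˡ : ∀ c (f : A → ℕ) xs → Σl (λ x → c * f x) xs ≡ c * Σl f xs
Σl-*ˡ c f [] = sym (*-zeroʳ c)
Σl-*ˡ c f (x ∷ xs) = trans (cong (c * f x +_) (Σl-*ˡ c f xs)) (sym (*-distribˡ-+ c (f x) (Σl f xs)))

Σl-*ʳ : ∀ c (f : A → ℕ) xs → Σl (λ x → f x * c) xs ≡ Σl f xs * c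
Σl-*ʳ c f xs = trans (Σl-cong xs (λ x → *-comm (f x) c)) (trans (Σl-*ˡ c f xs) (*-comm c (Σl f xs)))

Σl-zero : ∀ (xs : List A) → Σl (λ _ → 0) xs ≡ 0
Σl-zero [] = refl
Σl-zero (x ∷ xs) = Σl-zero xs

Σl-swap : ∀ (f : A → B → ℕ) xs ys →
  Σl (λ x → Σl (f x) ys) xs ≡ Σl (λ y → Σl (λ x → f x y) xs) ys
Σl-swap f [] ys = sym (Σl-zero ys)
Σl-swap f (x ∷ xs) ys = trans (cong (Σl (f x) ys +_) (Σl-swap f xs ys))
  (sym (Σl-+ (f x) (λ y → Σl (λ x → f x y) xs) ys))

Σl-∈ : ∀ (f : A → ℕ) {x xs} → x ∈ xs → f x ≤ Σl f xs
Σl-∈ f {xs = y ∷ ys} (here refl) = m≤m+n (f y) (Σl f ys)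
Σl-∈ f {xs = y ∷ ys} (there x∈) = ≤-trans (Σl-∈ f x∈) (m≤n+m (Σl f ys) (f y))

Σl-indicators-pos : ∀ (p q : A → Bool) {x xs} → x ∈ xs → p x ≡ true → q x ≡ true →
  1 ≤ Σl (λ x → ⟦ p x ⟧ * ⟦ q x ⟧) xs
Σl-indicators-pos p q x∈ px qx =
  ≤-trans (≤-reflexive (cong₂ (λ u v → ⟦ u ⟧ * ⟦ v ⟧) (sym px) (sym qx))) (Σl-∈ (λ x → ⟦ p x ⟧ * ⟦ q x ⟧) x∈)

Σl-++ : ∀ (f : A → ℕ) xs ys → Σl f (xs ++ ys) ≡ Σl f xs + Σl f ys
Σl-++ f xs ys = trans (cong sum (map-++ f xs ys)) (sum-++ (map f xs) (map f ys))

Σl-concatMap : ∀ (f : B → ℕ) (g : A → List B) xs →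
  Σl f (concatMap g xs) ≡ Σl (λ x → Σl f (g x)) xs
Σl-concatMap f g [] = refl
Σl-concatMap f g (x ∷ xs) =
  trans (Σl-++ f (g x) (concatMap g xs)) (cong (Σl f (g x) +_) (Σl-concatMap f g xs))

Σl-replicate : ∀ (f : A → ℕ) k x → Σl f (replicate k x) ≡ k * f x
Σl-replicate f zero x = refl
Σl-replicate f (suc k) x = cong (f x +_) (Σl-replicate f k x)

Σl-cartesianProduct : ∀ (f : A × B → ℕ) xs ys →
  Σl f (cartesianProduct xs ys) ≡ Σl (λ x → Σl (λ y → f (x , y)) ys) xs
Σl-cartesianProduct f [] ys = refl
Σl-cartesianProduct f (x ∷ xs) ys =
  trans (Σl-++ f (map (x ,_) ys) (cartesianProduct xs ys))
        (cong₂ _+_ (cong sum (sym (map-∘ ys))) (Σl-cartesianProduct f xs ys))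

double-count : ∀ (w : A → ℕ) (related : A → B → Bool) cs vs →
  Σl (λ v → Σl (λ c → w c * ⟦ related c v ⟧) cs) vs ≡ Σl (λ c → w c * length (filterᵇ (related c) vs)) cs
double-count w related cs vs = trans (Σl-swap (λ v c → w c * ⟦ related c v ⟧) vs cs) (Σl-cong cs (λ c →
  trans (Σl-*ˡ (w c) (λ v → ⟦ related c v ⟧) vs) (cong (w c *_) (sym (length-filterᵇ (related c) vs)))))

Σl-indicator-bound : ∀ (p : A → Bool) (f : A → ℕ) k t xs → (∀ x → p x ≡ true → f x * k ≤ t) →
  Σl (λ x → ⟦ p x ⟧ * f x) xs * k ≤ Σl (λ x → ⟦ p x ⟧) xs * t
Σl-indicator-bound p f k t xs bound = begin
  Σl (λ x → ⟦ p x ⟧ * f x) xs * k     ≡⟨ sym (Σl-*ʳ k (λ x → ⟦ p x ⟧ * f x) xs) ⟩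
  Σl (λ x → ⟦ p x ⟧ * f x * k) xs     ≤⟨ Σl-mono xs termwise ⟩
  Σl (λ x → ⟦ p x ⟧ * t) xs           ≡⟨ Σl-*ʳ t (λ x → ⟦ p x ⟧) xs ⟩
  Σl (λ x → ⟦ p x ⟧) xs * t           ∎
  where
  open ≤-Reasoning
  termwise : ∀ x → ⟦ p x ⟧ * f x * k ≤ ⟦ p x ⟧ * t
  termwise x with p x in px
  ... | false = z≤n
  ... | true = subst₂ _≤_ (sym (cong (_* k) (*-identityˡ (f x)))) (sym (*-identityˡ t)) (bound x px)

Σl-allFin : ∀ {n} (f : Fin n → ℕ) → Σl f (allFin n) ≡ sum (tabulate f)
Σl-allFin f = cong sum (map-tabulate (λ i → i) f)

Σl-positions : ∀ (f : A → ℕ) xs → Σl (λ i → f (lookup xs i)) (allFin (length xs)) ≡ Σl f xs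
Σl-positions f xs = trans (Σl-allFin (λ i → f (lookup xs i))) (go xs)
  where
  go : ∀ xs → sum (tabulate (λ i → f (lookup xs i))) ≡ Σl f xs
  go [] = refl
  go (x ∷ xs) = cong (f x +_) (go xs)

≡⇒== : ∀ {m} {x y : Fin m} → x ≡ y → (x == y) ≡ true
≡⇒== {x = x} {y} x≡y = trans (isYes≗does (x F.≟ y)) (dec-true (x F.≟ y) x≡y)

≢⇒== : ∀ {m} {x y : Fin m} → ¬ x ≡ y → (x == y) ≡ false
≢⇒== {x = x} {y} x≢y = trans (isYes≗does (x F.≟ y)) (dec-false (x F.≟ y) x≢y)

==⇒≡ : ∀ {m} {x y : Fin m} → (x == y) ≡ true → x ≡ y
==⇒≡ {x = x} {y} x==y = toWitness (subst T (sym x==y) tt)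

==⇒≢ : ∀ {m} {x y : Fin m} → (x == y) ≡ false → ¬ x ≡ y
==⇒≢ {x = x} {y} x≠y = toWitnessFalse (subst (λ z → T (not z)) (sym x≠y) tt)

==-suc : ∀ {m} (i c : Fin m) → (F.suc i == F.suc c) ≡ (i == c)
==-suc i c = ⌊⌋-map′ _ _ (i F.≟ c)

Σl-point : ∀ {m} (c : Fin m) (g : Fin m → ℕ) → Σl (λ i → ⟦ i == c ⟧ * g i) (allFin m) ≡ g c
Σl-point c g = trans (Σl-allFin (λ i → ⟦ i == c ⟧ * g i)) (go c g)
  where
  go : ∀ {m} (c : Fin m) (g : Fin m → ℕ) → sum (tabulate (λ i → ⟦ i == c ⟧ * g i)) ≡ g c
  go {suc m} F.zero g = begin
    g F.zero + 0 + sum (tabulate (λ i → ⟦ F.suc i == F.zero ⟧ * g (F.suc i)))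
      ≡⟨ cong (g F.zero + 0 +_) (trans (sym (Σl-allFin {n = m} (λ _ → 0))) (Σl-zero (allFin m))) ⟩
    g F.zero + 0 + 0 ≡⟨ trans (+-identityʳ _) (+-identityʳ _) ⟩
    g F.zero ∎
    where open ≡-Reasoning
  go {suc m} (F.suc c) g =
    trans (cong sum (tabulate-cong (λ i → cong (λ z → ⟦ z ⟧ * g (F.suc i)) (==-suc i c))))
          (go c (λ i → g (F.suc i)))

∧-elim : ∀ {x y} → (x ∧ y) ≡ true → x ≡ true × y ≡ true
∧-elim {true} {true} _ = refl , refl

∧-intro : ∀ {x y} → x ≡ true → y ≡ true → (x ∧ y) ≡ true
∧-intro refl refl = refl

∧≡false-elim : ∀ {x y} → (x ∧ y) ≡ false → x ≡ false ⊎ y ≡ false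
∧≡false-elim {false} _ = inj₁ refl
∧≡false-elim {true} y≡false = inj₂ y≡false

∧≡false-intro : ∀ {x y} → x ≡ false ⊎ y ≡ false → (x ∧ y) ≡ false
∧≡false-intro (inj₁ refl) = refl
∧≡false-intro {true} (inj₂ refl) = refl
∧≡false-intro {false} (inj₂ refl) = refl

∨-elim : ∀ {x y} → (x ∨ y) ≡ true → x ≡ true ⊎ y ≡ true
∨-elim {true} _ = inj₁ refl
∨-elim {false} y≡true = inj₂ y≡true

not-elim : ∀ {x} → not x ≡ true → x ≡ false
not-elim {false} _ = refl

not-intro : ∀ {x} → x ≡ false → not x ≡ true
not-intro refl = refl

all-elim : ∀ (p : A → Bool) {xs x} → all p xs ≡ true → x ∈ xs → p x ≡ true
all-elim p {y ∷ ys} all≡ (here refl) = proj₁ (∧-elim all≡)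
all-elim p {y ∷ ys} all≡ (there x∈) = all-elim p (proj₂ (∧-elim {p y} all≡)) x∈

all-intro : ∀ (p : A → Bool) xs → (∀ x → x ∈ xs → p x ≡ true) → all p xs ≡ true
all-intro p [] _ = refl
all-intro p (x ∷ xs) h = ∧-intro (h x (here refl)) (all-intro p xs (λ y y∈ → h y (there y∈)))

any-elim : ∀ (p : A → Bool) xs → any p xs ≡ true → ∃ λ x → x ∈ xs × p x ≡ true
any-elim p (x ∷ xs) any≡ with p x in px
... | true = x , here refl , px
... | false with any-elim p xs any≡
... | y , y∈ , py = y , there y∈ , py

any≡false-elim : ∀ (p : A → Bool) {xs x} → any p xs ≡ false → x ∈ xs → p x ≡ false
any≡false-elim p {y ∷ ys} any≡ x∈ with p y in py | x∈
... | false | here refl = py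
... | false | there x∈′ = any≡false-elim p any≡ x∈′

length-⊆ : ∀ {xs ys : List A} → Unique xs → (∀ {z} → z ∈ xs → z ∈ ys) → length xs ≤ length ys
length-⊆ {xs = []} _ _ = z≤n
length-⊆ {xs = x ∷ xs} {ys} (x∉xs ∷ xs-unique) xs⊆ys with ∈-∃++ (xs⊆ys (here refl))
... | ys₁ , ys₂ , refl = begin
  suc (length xs)             ≤⟨ s≤s (length-⊆ xs-unique xs⊆ys₁++ys₂) ⟩
  suc (length (ys₁ ++ ys₂))   ≡⟨ cong suc (length-++ ys₁) ⟩
  suc (length ys₁ + length ys₂) ≡⟨ sym (+-suc (length ys₁) (length ys₂)) ⟩
  length ys₁ + suc (length ys₂) ≡⟨ sym (length-++ ys₁) ⟩
  length (ys₁ ++ x ∷ ys₂)     ∎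
  where
  open ≤-Reasoning
  xs⊆ys₁++ys₂ : ∀ {z} → z ∈ xs → z ∈ ys₁ ++ ys₂
  xs⊆ys₁++ys₂ {z} z∈xs with ∈-++⁻ ys₁ (xs⊆ys (there z∈xs))
  ... | inj₁ z∈ys₁ = ∈-++⁺ˡ z∈ys₁
  ... | inj₂ (here refl) = ⊥-elim (All.lookup x∉xs z∈xs refl)
  ... | inj₂ (there z∈ys₂) = ∈-++⁺ʳ ys₁ z∈ys₂

map-unique-on : ∀ (g : A → B) {xs} → Unique xs →
  (∀ {u v} → u ∈ xs → v ∈ xs → g u ≡ g v → u ≡ v) → Unique (map g xs)
map-unique-on g {[]} _ _ = []
map-unique-on g {x ∷ xs} (x∉xs ∷ xs-unique) g-inj =
  AllP.map⁺ (All.tabulate (λ y∈xs gx≡gy → All.lookup x∉xs y∈xs (g-inj (here refl) (there y∈xs) gx≡gy)))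
  ∷ map-unique-on g xs-unique (λ u∈ v∈ → g-inj (there u∈) (there v∈))

length-cartesianProduct : ∀ (xs : List A) (ys : List B) →
  length (cartesianProduct xs ys) ≡ length xs * length ys
length-cartesianProduct [] ys = refl
length-cartesianProduct (x ∷ xs) ys =
  trans (length-++ (map (x ,_) ys)) (cong₂ _+_ (length-map (x ,_) ys) (length-cartesianProduct xs ys))

allVecs-suc : ∀ m k → allVecs m (suc k) ≡ cartesianProductWith _∷_ (allFin m) (allVecs m k)
allVecs-suc m k = go (allFin m)
  where
  go : ∀ xs → concatMap (λ x → map (x ∷_) (allVecs m k)) xs ≡ cartesianProductWith _∷_ xs (allVecs m k)
  go [] = refl
  go (x ∷ xs) = cong (map (x ∷_) (allVecs m k) ++_) (go xs)

∈-allVecs : ∀ m k (v : Vec (Fin m) k) → v ∈ allVecs m k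
∈-allVecs m zero [] = here refl
∈-allVecs m (suc k) (x ∷ v) rewrite allVecs-suc m k =
  ∈-cartesianProductWith⁺ _∷_ (∈-allFin x) (∈-allVecs m k v)

allVecs-unique : ∀ m k → Unique (allVecs m k)
allVecs-unique m zero = [] ∷ []
allVecs-unique m (suc k) rewrite allVecs-suc m k =
  cartesianProductWith⁺ _∷_ VP.∷-injective (allFin⁺ m) (allVecs-unique m k)

∈-filterᵇ⁻ : ∀ (p : A → Bool) {xs x} → x ∈ filterᵇ p xs → x ∈ xs × p x ≡ true
∈-filterᵇ⁻ p x∈ = Data.Product.map₂ (Equivalence.to T-≡) (∈-filter⁻ (T? ∘ p) x∈)

∈-filterᵇ⁺ : ∀ (p : A → Bool) {xs x} → x ∈ xs → p x ≡ true → x ∈ filterᵇ p xs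
∈-filterᵇ⁺ p x∈ px = ∈-filter⁺ (T? ∘ p) x∈ (Equivalence.from T-≡ px)

filterᵇ-unique : ∀ (p : A → Bool) {xs} → Unique xs → Unique (filterᵇ p xs)
filterᵇ-unique p = filter⁺ (T? ∘ p)

lookup-ext : ∀ {k} {u v : Vec A k} → (∀ i → V.lookup u i ≡ V.lookup v i) → u ≡ v
lookup-ext {u = u} {v} u≗v = trans (sym (VP.tabulate∘lookup u)) (trans (VP.tabulate-cong u≗v) (VP.tabulate∘lookup v))

≤-dmax : ∀ {n} (d : Fin n → ℕ) i → d i ≤ dmax d
≤-dmax {n} d i = go (allFin n) (∈-allFin i)
  where
  go : ∀ xs → i ∈ xs → d i ≤ foldr _⊔_ 0 (map d xs)
  go (x ∷ xs) (here refl) = m≤m⊔n (d x) _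
  go (x ∷ xs) (there i∈xs) = ≤-trans (go xs i∈xs) (m≤n⊔m (d x) _)

module Pairings {n} (d : Fin n → ℕ) (inL : Fin n → Bool) where

  Pt : Set
  Pt = Fin (npts d)

  own : Pt → Fin n
  own = owner d

  all-points : List Pt
  all-points = allFin (npts d)

  all-candidates : List (Cand d)
  all-candidates = allVecs (npts d) (npts d)

  infix 30 _⟨_⟩
  _⟨_⟩ : Cand d → Pt → Pt
  P ⟨ i ⟩ = V.lookup P i

  InR : Pt → Set
  InR i = inL (own i) ≡ false

  InR-by-vertex : ∀ {u w} → own u ≡ own w → InR w → InR u
  InR-by-vertex same w∈R = trans (cong inL same) w∈R

  record IsRestrictedPairing (P : Cand d) : Set where
    field
      involutive : ∀ i → P ⟨ P ⟨ i ⟩ ⟩ ≡ i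
      fixpoint-free : ∀ i → ¬ P ⟨ i ⟩ ≡ i
      restricted : ∀ i → InR i ⊎ InR (P ⟨ i ⟩)

  restricted? : Cand d → Bool
  restricted? P = isPairing d P ∧ isRestricted d inL P

  restricted?-sound : ∀ {P} → restricted? P ≡ true → IsRestrictedPairing P
  restricted?-sound {P} ok = record
    { involutive = λ i → ==⇒≡ (proj₁ (∧-elim (pairing i)))
    ; fixpoint-free = λ i → ==⇒≢ (not-elim (proj₂ (∧-elim {P ⟨ P ⟨ i ⟩ ⟩ == i} (pairing i))))
    ; restricted = λ i → ∧≡false-elim (not-elim
        (all-elim (λ x → not (inL (own x) ∧ inL (own (P ⟨ x ⟩)))) (proj₂ (∧-elim {isPairing d P} ok)) (∈-allFin i)))
    }
    where
    pairing : ∀ i → ((P ⟨ P ⟨ i ⟩ ⟩ == i) ∧ not (P ⟨ i ⟩ == i)) ≡ true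
    pairing i = all-elim (λ x → (P ⟨ P ⟨ x ⟩ ⟩ == x) ∧ not (P ⟨ x ⟩ == x)) (proj₁ (∧-elim ok)) (∈-allFin i)

  restricted?-complete : ∀ {P} → IsRestrictedPairing P → restricted? P ≡ true
  restricted?-complete {P} rp = ∧-intro
    (all-intro _ all-points (λ i _ → ∧-intro (≡⇒== (involutive i)) (not-intro (≢⇒== (fixpoint-free i)))))
    (all-intro _ all-points (λ i _ → not-intro (∧≡false-intro (restricted i))))
    where open IsRestrictedPairing rp

  -- The switching operation: given pairs {x, x'} and {b, a} (where a = P ⟨ b ⟩),
  -- replace them by {x, b} and {x', a}.
  switch : Cand d → Pt → Pt → Pt → Cand d
  switch P x x' b = P V.[ P ⟨ b ⟩ ]≔ x' V.[ x' ]≔ P ⟨ b ⟩ V.[ b ]≔ x V.[ x ]≔ b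

  module Switching (P : Cand d) (rp : IsRestrictedPairing P) (x x' b : Pt)
                   (Px : P ⟨ x ⟩ ≡ x') (x'∈R : InR x') (b∈R : InR b)
                   (b≢x : ¬ b ≡ x) (b≢x' : ¬ b ≡ x') where
    open IsRestrictedPairing rp

    a : Pt
    a = P ⟨ b ⟩

    Q₁ Q₂ Q₃ Q : Cand d
    Q₁ = P V.[ a ]≔ x'
    Q₂ = Q₁ V.[ x' ]≔ a
    Q₃ = Q₂ V.[ b ]≔ x
    Q = Q₃ V.[ x ]≔ b

    x≢x' : ¬ x ≡ x'
    x≢x' x≡x' = fixpoint-free x (trans Px (sym x≡x'))

    Px' : P ⟨ x' ⟩ ≡ x
    Px' = trans (cong (P ⟨_⟩) (sym Px)) (involutive x)

    Pa : P ⟨ a ⟩ ≡ b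
    Pa = involutive b

    a≢b : ¬ a ≡ b
    a≢b = fixpoint-free b

    a≢x : ¬ a ≡ x
    a≢x a≡x = b≢x' (trans (sym Pa) (trans (cong (P ⟨_⟩) a≡x) Px))

    a≢x' : ¬ a ≡ x'
    a≢x' a≡x' = b≢x (trans (sym Pa) (trans (cong (P ⟨_⟩) a≡x') Px'))

    Qx : Q ⟨ x ⟩ ≡ b
    Qx = VP.lookup∘update x Q₃ b

    Qb : Q ⟨ b ⟩ ≡ x
    Qb = trans (VP.lookup∘update′ b≢x Q₃ b) (VP.lookup∘update b Q₂ x)

    Qx' : Q ⟨ x' ⟩ ≡ a
    Qx' = trans (VP.lookup∘update′ (x≢x' ∘ sym) Q₃ b)
         (trans (VP.lookup∘update′ (b≢x' ∘ sym) Q₂ x) (VP.lookup∘update x' Q₁ a))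

    Qa : Q ⟨ a ⟩ ≡ x'
    Qa = trans (VP.lookup∘update′ a≢x Q₃ b) (trans (VP.lookup∘update′ a≢b Q₂ x)
         (trans (VP.lookup∘update′ a≢x' Q₁ a) (VP.lookup∘update a P x')))

    Q-other : ∀ i → ¬ i ≡ x → ¬ i ≡ b → ¬ i ≡ x' → ¬ i ≡ a → Q ⟨ i ⟩ ≡ P ⟨ i ⟩
    Q-other i i≢x i≢b i≢x' i≢a = trans (VP.lookup∘update′ i≢x Q₃ b) (trans (VP.lookup∘update′ i≢b Q₂ x)
         (trans (VP.lookup∘update′ i≢x' Q₁ a) (VP.lookup∘update′ i≢a P x')))

    data Position (i : Pt) : Set where
      at-x : i ≡ x → Position i
      at-b : i ≡ b → Position i
      at-x' : i ≡ x' → Position i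
      at-a : i ≡ a → Position i
      other : ¬ i ≡ x → ¬ i ≡ b → ¬ i ≡ x' → ¬ i ≡ a → Position i

    position : ∀ i → Position i
    position i with i F.≟ x | i F.≟ b | i F.≟ x' | i F.≟ a
    ... | yes i≡x | _ | _ | _ = at-x i≡x
    ... | no _ | yes i≡b | _ | _ = at-b i≡b
    ... | no _ | no _ | yes i≡x' | _ = at-x' i≡x'
    ... | no _ | no _ | no _ | yes i≡a = at-a i≡a
    ... | no i≢x | no i≢b | no i≢x' | no i≢a = other i≢x i≢b i≢x' i≢a

    P-other : ∀ i → ¬ i ≡ x → ¬ i ≡ b → ¬ i ≡ x' → ¬ i ≡ a →
              (¬ P ⟨ i ⟩ ≡ x) × (¬ P ⟨ i ⟩ ≡ b) × (¬ P ⟨ i ⟩ ≡ x') × (¬ P ⟨ i ⟩ ≡ a)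
    P-other i i≢x i≢b i≢x' i≢a =
      (λ e → i≢x' (trans (sym (involutive i)) (trans (cong (P ⟨_⟩) e) Px))) ,
      (λ e → i≢a (trans (sym (involutive i)) (cong (P ⟨_⟩) e))) ,
      (λ e → i≢x (trans (sym (involutive i)) (trans (cong (P ⟨_⟩) e) Px'))) ,
      (λ e → i≢b (trans (sym (involutive i)) (trans (cong (P ⟨_⟩) e) Pa)))

    switched : IsRestrictedPairing Q
    switched = record { involutive = Q-involutive ; fixpoint-free = Q-fixpoint-free ; restricted = Q-restricted }
      where
      Q-involutive : ∀ i → Q ⟨ Q ⟨ i ⟩ ⟩ ≡ i
      Q-involutive i with position i
      ... | at-x refl = trans (cong (Q ⟨_⟩) Qx) Qb
      ... | at-b refl = trans (cong (Q ⟨_⟩) Qb) Qx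
      ... | at-x' refl = trans (cong (Q ⟨_⟩) Qx') Qa
      ... | at-a refl = trans (cong (Q ⟨_⟩) Qa) Qx'
      ... | other i≢x i≢b i≢x' i≢a with P-other i i≢x i≢b i≢x' i≢a
      ... | j≢x , j≢b , j≢x' , j≢a =
        trans (cong (Q ⟨_⟩) (Q-other i i≢x i≢b i≢x' i≢a)) (trans (Q-other (P ⟨ i ⟩) j≢x j≢b j≢x' j≢a) (involutive i))

      Q-fixpoint-free : ∀ i → ¬ Q ⟨ i ⟩ ≡ i
      Q-fixpoint-free i with position i
      ... | at-x refl = λ e → b≢x (trans (sym Qx) e)
      ... | at-b refl = λ e → b≢x (sym (trans (sym Qb) e))
      ... | at-x' refl = λ e → a≢x' (trans (sym Qx') e)
      ... | at-a refl = λ e → a≢x' (sym (trans (sym Qa) e))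
      ... | other i≢x i≢b i≢x' i≢a = λ e → fixpoint-free i (trans (sym (Q-other i i≢x i≢b i≢x' i≢a)) e)

      Q-restricted : ∀ i → InR i ⊎ InR (Q ⟨ i ⟩)
      Q-restricted i with position i
      ... | at-x refl = inj₂ (subst InR (sym Qx) b∈R)
      ... | at-b refl = inj₁ b∈R
      ... | at-x' refl = inj₁ x'∈R
      ... | at-a refl = inj₂ (subst InR (sym Qa) x'∈R)
      ... | other i≢x i≢b i≢x' i≢a = Data.Sum.map₂ (subst InR (sym (Q-other i i≢x i≢b i≢x' i≢a))) (restricted i)

    Q-keeps : ∀ c e → P ⟨ c ⟩ ≡ e → ¬ c ≡ x → ¬ c ≡ x' → ¬ c ≡ b → ¬ e ≡ b → Q ⟨ c ⟩ ≡ e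
    Q-keeps c e Pc c≢x c≢x' c≢b e≢b = trans (Q-other c c≢x c≢b c≢x' c≢a) Pc
      where
      c≢a : ¬ c ≡ a
      c≢a c≡a = e≢b (trans (sym Pc) (trans (cong (P ⟨_⟩) c≡a) Pa))

  -- The switch can be undone: from Q and the pair {x, x'} one reads off
  -- b = Q ⟨ x ⟩, a = Q ⟨ x' ⟩, and hence P.
  switch-injective : ∀ P₁ P₂ (rp₁ : IsRestrictedPairing P₁) (rp₂ : IsRestrictedPairing P₂) x x' b₁ b₂ →
    (P₁x : P₁ ⟨ x ⟩ ≡ x') (P₂x : P₂ ⟨ x ⟩ ≡ x') (x'∈R : InR x') (b₁∈R : InR b₁) (b₂∈R : InR b₂)
    (b₁≢x : ¬ b₁ ≡ x) (b₁≢x' : ¬ b₁ ≡ x') (b₂≢x : ¬ b₂ ≡ x) (b₂≢x' : ¬ b₂ ≡ x') →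
    switch P₁ x x' b₁ ≡ switch P₂ x x' b₂ → P₁ ≡ P₂ × b₁ ≡ b₂
  switch-injective P₁ P₂ rp₁ rp₂ x x' b₁ b₂ P₁x P₂x x'∈R b₁∈R b₂∈R b₁≢x b₁≢x' b₂≢x b₂≢x' Q₁≡Q₂ =
    lookup-ext same-entries , b₁≡b₂
    where
    module S₁ = Switching P₁ rp₁ x x' b₁ P₁x x'∈R b₁∈R b₁≢x b₁≢x'
    module S₂ = Switching P₂ rp₂ x x' b₂ P₂x x'∈R b₂∈R b₂≢x b₂≢x'
    b₁≡b₂ : b₁ ≡ b₂
    b₁≡b₂ = trans (sym S₁.Qx) (trans (cong (_⟨ x ⟩) Q₁≡Q₂) S₂.Qx)
    a₁≡a₂ : S₁.a ≡ S₂.a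
    a₁≡a₂ = trans (sym S₁.Qx') (trans (cong (_⟨ x' ⟩) Q₁≡Q₂) S₂.Qx')
    same-entries : ∀ i → P₁ ⟨ i ⟩ ≡ P₂ ⟨ i ⟩
    same-entries i with S₁.position i
    ... | S₁.at-x refl = trans P₁x (sym P₂x)
    ... | S₁.at-b refl = trans a₁≡a₂ (cong (P₂ ⟨_⟩) (sym b₁≡b₂))
    ... | S₁.at-x' refl = trans S₁.Px' (sym S₂.Px')
    ... | S₁.at-a refl = trans S₁.Pa (trans b₁≡b₂ (trans (sym S₂.Pa) (cong (P₂ ⟨_⟩) (sym a₁≡a₂))))
    ... | S₁.other i≢x i≢b i≢x' i≢a = trans (sym (S₁.Q-other i i≢x i≢b i≢x' i≢a))
          (trans (cong (_⟨ i ⟩) Q₁≡Q₂)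
                 (S₂.Q-other i i≢x (λ e → i≢b (trans e (sym b₁≡b₂))) i≢x' (λ e → i≢a (trans e (sym a₁≡a₂)))))

  contains? : List (Pt × Pt) → Cand d → Bool
  contains? F P = all (λ ce → P ⟨ proj₁ ce ⟩ == proj₂ ce) F

  containing : List (Pt × Pt) → List (Cand d)
  containing F = filterᵇ (λ P → restricted? P ∧ contains? F P) all-candidates

  support : List (Pt × Pt) → List Pt
  support [] = []
  support ((c , e) ∷ F) = c ∷ e ∷ support F

  support-∈ : ∀ {c e} F → (c , e) ∈ F → c ∈ support F × e ∈ support F
  support-∈ (_ ∷ F) (here refl) = here refl , there (here refl)
  support-∈ (_ ∷ F) (there ce∈F) = Data.Product.map (there ∘ there) (there ∘ there) (support-∈ F ce∈F)

  ∈-containing⁻ : ∀ {F P} → P ∈ containing F → IsRestrictedPairing P × (∀ c e → (c , e) ∈ F → P ⟨ c ⟩ ≡ e)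
  ∈-containing⁻ {F} {P} P∈ with ∈-filterᵇ⁻ (λ P → restricted? P ∧ contains? F P) {xs = all-candidates} P∈
  ... | _ , ok = restricted?-sound (proj₁ (∧-elim ok))
               , λ c e ce∈F → ==⇒≡ (all-elim (λ ce → P ⟨ proj₁ ce ⟩ == proj₂ ce) (proj₂ (∧-elim {restricted? P} ok)) ce∈F)

  ∈-containing⁺ : ∀ {F P} → IsRestrictedPairing P → (∀ c e → (c , e) ∈ F → P ⟨ c ⟩ ≡ e) → P ∈ containing F
  ∈-containing⁺ {F} {P} rp P⊇F = ∈-filterᵇ⁺ (λ P → restricted? P ∧ contains? F P) (∈-allVecs _ _ P)
    (∧-intro (restricted?-complete rp) (all-intro _ F (λ { (c , e) ce∈F → ≡⇒== (P⊇F c e ce∈F) })))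

  freeR? : List Pt → Pt → Bool
  freeR? s b = not (inL (own b)) ∧ not (any (b ==_) s)

  freeR : List Pt → List Pt
  freeR s = filterᵇ (freeR? s) (all-points)

  ∈-freeR⁻ : ∀ {s b} → b ∈ freeR s → InR b × (∀ z → z ∈ s → ¬ b ≡ z)
  ∈-freeR⁻ {s} {b} b∈ with ∈-filterᵇ⁻ (freeR? s) {xs = all-points} b∈
  ... | _ , free = not-elim (proj₁ (∧-elim free))
                 , λ z z∈s → ==⇒≢ (any≡false-elim (b ==_) (not-elim (proj₂ (∧-elim {not (inL (own b))} free))) z∈s)

  -- The switching bound: every restricted pairing containing {x, x'} and F
  -- switches, with any free point b of R, to a distinct restricted pairing
  -- still containing F.
  switching-bound : ∀ F x x' → InR x' → (∀ z → z ∈ support F → ¬ z ≡ x × ¬ z ≡ x') →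
    length (containing ((x , x') ∷ F)) * length (freeR (x ∷ x' ∷ support F)) ≤ length (containing F)
  switching-bound F x x' x'∈R F-avoids = begin
    length before * length free            ≡⟨ sym (length-cartesianProduct before free) ⟩
    length (cartesianProduct before free)  ≡⟨ sym (length-map sw (cartesianProduct before free)) ⟩
    length (map sw (cartesianProduct before free))
      ≤⟨ length-⊆ (map-unique-on sw domain-unique sw-injective) image⊆ ⟩
    length (containing F)                  ∎
    where
    open ≤-Reasoning
    before = containing ((x , x') ∷ F)
    free = freeR (x ∷ x' ∷ support F)
    sw : Cand d × Pt → Cand d
    sw (P , b) = switch P x x' b
    domain-unique : Unique (cartesianProduct before free)
    domain-unique = cartesianProduct⁺ (filterᵇ-unique _ (allVecs-unique _ _)) (filterᵇ-unique _ (allFin⁺ _))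

    before⁻ : ∀ {P} → P ∈ before → IsRestrictedPairing P × P ⟨ x ⟩ ≡ x' × (∀ c e → (c , e) ∈ F → P ⟨ c ⟩ ≡ e)
    before⁻ P∈ = let (rp , P⊇) = ∈-containing⁻ P∈ in rp , P⊇ x x' (here refl) , (λ c e ce∈F → P⊇ c e (there ce∈F))
    free⁻ : ∀ {b} → b ∈ free → InR b × ¬ b ≡ x × ¬ b ≡ x' × (∀ z → z ∈ support F → ¬ b ≡ z)
    free⁻ b∈ = let (b∈R , b∉) = ∈-freeR⁻ b∈ in
      b∈R , b∉ x (here refl) , b∉ x' (there (here refl)) , (λ z z∈ → b∉ z (there (there z∈)))

    sw-injective : ∀ {u v} → u ∈ cartesianProduct before free → v ∈ cartesianProduct before free → sw u ≡ sw v → u ≡ v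
    sw-injective {P₁ , b₁} {P₂ , b₂} u∈ v∈ sw≡
      with ∈-cartesianProduct⁻ before free u∈ | ∈-cartesianProduct⁻ before free v∈
    ... | P₁∈ , b₁∈ | P₂∈ , b₂∈ with before⁻ P₁∈ | before⁻ P₂∈ | free⁻ b₁∈ | free⁻ b₂∈
    ... | rp₁ , P₁x , _ | rp₂ , P₂x , _ | b₁∈R , b₁≢x , b₁≢x' , _ | b₂∈R , b₂≢x , b₂≢x' , _ =
      let (P₁≡P₂ , b₁≡b₂) = switch-injective P₁ P₂ rp₁ rp₂ x x' b₁ b₂ P₁x P₂x x'∈R b₁∈R b₂∈R
                              b₁≢x b₁≢x' b₂≢x b₂≢x' sw≡
      in cong₂ _,_ P₁≡P₂ b₁≡b₂

    image⊆ : ∀ {Q} → Q ∈ map sw (cartesianProduct before free) → Q ∈ containing F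
    image⊆ Q∈ with ∈-map⁻ sw Q∈
    ... | (P , b) , Pb∈ , refl with ∈-cartesianProduct⁻ before free Pb∈
    ... | P∈ , b∈ with before⁻ P∈ | free⁻ b∈
    ... | rp , Px , P⊇F | b∈R , b≢x , b≢x' , b∉F = ∈-containing⁺ S.switched
      (λ c e ce∈F → let (c∈ , e∈) = support-∈ F ce∈F in
        S.Q-keeps c e (P⊇F c e ce∈F) (proj₁ (F-avoids c c∈)) (proj₂ (F-avoids c c∈))
                  (λ c≡b → b∉F c c∈ (sym c≡b)) (λ e≡b → b∉F e e∈ (sym e≡b)))
      where module S = Switching P rp x x' b Px x'∈R b∈R b≢x b≢x'

  Σ-points : ∀ (f : Fin n → ℕ) → Σl (λ u → f (own u)) (all-points) ≡ Σl (λ i → d i * f i) (allFin n)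
  Σ-points f = begin
    Σl (λ u → f (own u)) (all-points)                    ≡⟨ Σl-positions f (points d) ⟩
    Σl f (points d)                                           ≡⟨ Σl-concatMap f (λ i → replicate (d i) i) (allFin n) ⟩
    Σl (λ i → Σl f (replicate (d i) i)) (allFin n)            ≡⟨ Σl-cong (allFin n) (λ i → Σl-replicate f (d i) i) ⟩
    Σl (λ i → d i * f i) (allFin n)                           ∎
    where open ≡-Reasoning

  degree : ∀ c → Σl (λ u → ⟦ own u == c ⟧) (all-points) ≡ d c
  degree c = begin
    Σl (λ u → ⟦ own u == c ⟧) (all-points)  ≡⟨ Σ-points (λ i → ⟦ i == c ⟧) ⟩
    Σl (λ i → d i * ⟦ i == c ⟧) (allFin n)       ≡⟨ Σl-cong (allFin n) (λ i → *-comm (d i) ⟦ i == c ⟧) ⟩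
    Σl (λ i → ⟦ i == c ⟧ * d i) (allFin n)       ≡⟨ Σl-point c d ⟩
    d c                                          ∎
    where open ≡-Reasoning

  M1R : ℕ
  M1R = M1 d inL false

  -- The summands of M₁ and M₂(R) are local to their definitions in Defs, so
  -- the pointwise lemmas below leave them as "_", fixed by unification with
  -- the lemma using them (hence the mutual blocks).

  mutual
    M1-split : M1 d inL true + M1R ≡ M d
    M1-split = trans (sym (Σl-+ _ _ (allFin n))) (Σl-cong (allFin n) M1-split-at)

    M1-split-at : ∀ i → _ ≡ d i
    M1-split-at i with inL i
    ... | true = +-identityʳ (d i)
    ... | false = refl

  mutual
    #points-in-R : Σl (λ u → ⟦ not (inL (own u)) ⟧) (all-points) ≡ M1R
    #points-in-R = trans (Σ-points (λ i → ⟦ not (inL i) ⟧)) (Σl-cong (allFin n) #points-in-R-at)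

    #points-in-R-at : ∀ i → d i * ⟦ not (inL i) ⟧ ≡ _
    #points-in-R-at i with inL i
    ... | true = *-zeroʳ (d i)
    ... | false = *-identityʳ (d i)

  mutual
    M2R-as-sum : Σl (λ i → d i * (⟦ not (inL i) ⟧ * (d i ∸ 1))) (allFin n) ≡ M2R d inL
    M2R-as-sum = Σl-cong (allFin n) M2R-at

    M2R-at : ∀ i → d i * (⟦ not (inL i) ⟧ * (d i ∸ 1)) ≡ _
    M2R-at i with inL i
    ... | true = *-zeroʳ (d i)
    ... | false = cong (d i *_) (+-identityʳ (d i ∸ 1))

  #in-list : ∀ s → Σl (λ u → ⟦ any (u ==_) s ⟧) (all-points) ≤ length s
  #in-list [] = ≤-reflexive (Σl-zero (all-points))
  #in-list (c ∷ s) = begin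
    Σl (λ u → ⟦ any (u ==_) (c ∷ s) ⟧) (all-points)                     ≤⟨ Σl-mono (all-points) split ⟩
    Σl (λ u → ⟦ u == c ⟧ * 1 + ⟦ any (u ==_) s ⟧) (all-points)          ≡⟨ Σl-+ _ _ (all-points) ⟩
    Σl (λ u → ⟦ u == c ⟧ * 1) (all-points) + Σl (λ u → ⟦ any (u ==_) s ⟧) (all-points)
                                                                       ≤⟨ +-mono-≤ (≤-reflexive (Σl-point c (λ _ → 1))) (#in-list s) ⟩
    suc (length s)                                                     ∎
    where
    open ≤-Reasoning
    split : ∀ u → ⟦ any (u ==_) (c ∷ s) ⟧ ≤ ⟦ u == c ⟧ * 1 + ⟦ any (u ==_) s ⟧
    split u with u == c
    ... | true = s≤s z≤n
    ... | false = ≤-refl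

  #freeR : ∀ s → M1R ≤ length (freeR s) + length s
  #freeR s = begin
    M1R                                                            ≡⟨ sym #points-in-R ⟩
    Σl (λ u → ⟦ not (inL (own u)) ⟧) (all-points)                    ≤⟨ Σl-mono (all-points) split ⟩
    Σl (λ u → ⟦ freeR? s u ⟧ + ⟦ any (u ==_) s ⟧) (all-points)       ≡⟨ Σl-+ _ _ (all-points) ⟩
    Σl (λ u → ⟦ freeR? s u ⟧) (all-points) + Σl (λ u → ⟦ any (u ==_) s ⟧) (all-points)
                             ≤⟨ +-mono-≤ (≤-reflexive (sym (length-filterᵇ (freeR? s) (all-points)))) (#in-list s) ⟩
    length (freeR s) + length s                                    ∎
    where
    open ≤-Reasoning
    split : ∀ u → ⟦ not (inL (own u)) ⟧ ≤ ⟦ freeR? s u ⟧ + ⟦ any (u ==_) s ⟧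
    split u with inL (own u) | any (u ==_) s
    ... | true | _ = z≤n
    ... | false | false = ≤-refl
    ... | false | true = s≤s z≤n

  -- A lower bound for the number of free points of R when at most four
  -- points are excluded.
  K : ℕ
  K = M1R ∸ 4

  K≤#freeR : ∀ s → length s ≤ 4 → K ≤ length (freeR s)
  K≤#freeR s |s|≤4 = m≤n+o⇒m∸n≤o M1R 4
    (≤-trans (#freeR s) (≤-trans (+-monoʳ-≤ (length (freeR s)) |s|≤4) (≤-reflexive (+-comm (length (freeR s)) 4))))

  K≤M : K ≤ M d
  K≤M = ≤-trans (m∸n≤m M1R 4) (≤-trans (m≤n+m M1R (M1 d inL true)) (≤-reflexive M1-split))

  #containing-[] : length (containing []) ≡ nRestricted d inL
  #containing-[] = begin
    length (containing [])                             ≡⟨ length-filterᵇ _ all-candidates ⟩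
    Σl (λ P → ⟦ restricted? P ∧ true ⟧) all-candidates
      ≡⟨ Σl-cong all-candidates (λ P → cong ⟦_⟧ (∧-identityʳ (restricted? P))) ⟩
    Σl (λ P → ⟦ restricted? P ⟧) all-candidates        ≡⟨ sym (length-filterᵇ restricted? all-candidates) ⟩
    nRestricted d inL                                  ∎
    where open ≡-Reasoning

  -- Pairings containing a prescribed pair {x, x'} with x' ∈ R are rare:
  -- one switching maps K of them to each restricted pairing at most once.
  one-pair-bound : ∀ x x' → InR x' → length (containing ((x , x') ∷ [])) * K ≤ nRestricted d inL
  one-pair-bound x x' x'∈R = begin
    length (containing ((x , x') ∷ [])) * K
      ≤⟨ *-monoʳ-≤ (length (containing ((x , x') ∷ []))) (K≤#freeR (x ∷ x' ∷ []) (s≤s (s≤s z≤n))) ⟩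
    length (containing ((x , x') ∷ [])) * length (freeR (x ∷ x' ∷ []))
      ≤⟨ switching-bound [] x x' x'∈R (λ _ ()) ⟩
    length (containing [])   ≡⟨ #containing-[] ⟩
    nRestricted d inL        ∎
    where open ≤-Reasoning

  -- Two disjoint prescribed pairs, each with an endpoint in R: switch twice.
  two-pair-bound : ∀ x x' y y' → InR x' → InR y' →
    ¬ y ≡ x → ¬ y ≡ x' → ¬ y' ≡ x → ¬ y' ≡ x' →
    length (containing ((x , x') ∷ (y , y') ∷ [])) * K * K ≤ nRestricted d inL
  two-pair-bound x x' y y' x'∈R y'∈R y≢x y≢x' y'≢x y'≢x' = begin
    length (containing ((x , x') ∷ (y , y') ∷ [])) * K * K
      ≤⟨ *-monoˡ-≤ K (*-monoʳ-≤ (length (containing ((x , x') ∷ (y , y') ∷ []))) (K≤#freeR (x ∷ x' ∷ y ∷ y' ∷ []) ≤-refl)) ⟩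
    length (containing ((x , x') ∷ (y , y') ∷ [])) * length (freeR (x ∷ x' ∷ y ∷ y' ∷ [])) * K
      ≤⟨ *-monoˡ-≤ K (switching-bound ((y , y') ∷ []) x x' x'∈R avoids) ⟩
    length (containing ((y , y') ∷ [])) * K
      ≤⟨ one-pair-bound y y' y'∈R ⟩
    nRestricted d inL ∎
    where
    open ≤-Reasoning
    avoids : ∀ z → z ∈ y ∷ y' ∷ [] → ¬ z ≡ x × ¬ z ≡ x'
    avoids z (here refl) = y≢x , y≢x'
    avoids z (there (here refl)) = y'≢x , y'≢x'

  -- u and w are distinct points of one vertex of R.  A loop {u, w} of a
  -- restricted pairing always has this form.
  twinsR? : Pt × Pt → Bool
  twinsR? (u , w) = (own u == own w) ∧ (not (u == w) ∧ not (inL (own w)))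

  doubleR? : (Pt × Pt) × (Pt × Pt) → Bool
  doubleR? ((x , y) , (x' , y')) = (own x == own y) ∧ (twinsR? (x' , y') ∧ (not (x == y) ∧ (not (x == y') ∧ not (x' == y))))

  pairsOf : (Pt × Pt) × (Pt × Pt) → List (Pt × Pt)
  pairsOf ((x , y) , (x' , y')) = (x , x') ∷ (y , y') ∷ []

  twinsR-intro : ∀ {u w} → own u ≡ own w → ¬ u ≡ w → InR w → twinsR? (u , w) ≡ true
  twinsR-intro same u≢w w∈R = ∧-intro (≡⇒== same) (∧-intro (not-intro (≢⇒== u≢w)) (not-intro w∈R))

  twinsR⇒InR : ∀ {u w} → twinsR? (u , w) ≡ true → InR w
  twinsR⇒InR {u} {w} twins = not-elim (proj₂ (∧-elim (proj₂ (∧-elim {own u == own w} twins))))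

  doubleR-intro : ∀ {x y x' y'} → own x ≡ own y → own x' ≡ own y' → InR y' →
    ¬ x ≡ y → ¬ x' ≡ y' → ¬ x ≡ y' → ¬ x' ≡ y → doubleR? ((x , y) , (x' , y')) ≡ true
  doubleR-intro same same' y'∈R x≢y x'≢y' x≢y' x'≢y =
    ∧-intro (≡⇒== same) (∧-intro (twinsR-intro same' x'≢y' y'∈R)
      (∧-intro (not-intro (≢⇒== x≢y)) (∧-intro (not-intro (≢⇒== x≢y')) (not-intro (≢⇒== x'≢y)))))

  doubleR-elim : ∀ {x y x' y'} → doubleR? ((x , y) , (x' , y')) ≡ true →
    InR x' × InR y' × ¬ x ≡ y × ¬ x' ≡ y' × ¬ x ≡ y' × ¬ x' ≡ y
  doubleR-elim {x} {y} {x'} {y'} double with ∧-elim {own x == own y} double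
  ... | _ , rest with ∧-elim {twinsR? (x' , y')} rest
  ... | twins , distinct with ∧-elim {own x' == own y'} twins | ∧-elim {not (x == y)} distinct
  ... | same' , twins' | x≢y , distinct' with ∧-elim {not (x' == y')} twins' | ∧-elim {not (x == y')} distinct'
  ... | x'≢y' , y'∈R | x≢y' , x'≢y =
    InR-by-vertex (==⇒≡ same') (not-elim y'∈R) , not-elim y'∈R , ==⇒≢ (not-elim x≢y)
    , ==⇒≢ (not-elim x'≢y') , ==⇒≢ (not-elim x≢y') , ==⇒≢ (not-elim x'≢y)

  all-pairs : List (Pt × Pt)
  all-pairs = cartesianProduct all-points all-points

  ∈-all-pairs : ∀ u w → (u , w) ∈ all-pairs
  ∈-all-pairs u w = ∈-cartesianProduct⁺ (∈-allFin u) (∈-allFin w)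

  bad? : Cand d → Bool
  bad? v = isPairing d v ∧ isRestricted d inL v ∧ (hasLoop d v ∨ hasDoublePair d v)

  #loops : Cand d → ℕ
  #loops v = Σl (λ c → ⟦ twinsR? c ⟧ * ⟦ restricted? v ∧ contains? (c ∷ []) v ⟧) all-pairs

  #doubles : Cand d → ℕ
  #doubles v = Σl (λ cc → ⟦ doubleR? cc ⟧ * ⟦ restricted? v ∧ contains? (pairsOf cc) v ⟧)
                  (cartesianProduct all-pairs all-pairs)

  loop-witness : ∀ {v} → restricted? v ≡ true → ∀ x → own x ≡ own (v ⟨ x ⟩) → 1 ≤ #loops v
  loop-witness {v} ok x loop =
    Σl-indicators-pos twinsR? (λ c → restricted? v ∧ contains? (c ∷ []) v) (∈-all-pairs x (v ⟨ x ⟩))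
      (twinsR-intro loop (λ x≡vx → fixpoint-free x (sym x≡vx)) vx∈R)
      (∧-intro ok (∧-intro (≡⇒== {x = v ⟨ x ⟩} refl) refl))
    where
    open IsRestrictedPairing (restricted?-sound {v} ok)
    vx∈R : InR (v ⟨ x ⟩)
    vx∈R with restricted x
    ... | inj₁ x∈R = InR-by-vertex (sym loop) x∈R
    ... | inj₂ vx∈R = vx∈R

  -- A double pair {x, v ⟨ x ⟩}, {y, v ⟨ y ⟩} of a restricted pairing is a
  -- double-pair configuration, read from whichever side lies in R.
  double-witness : ∀ {v} → restricted? v ≡ true → ∀ x y →
    ¬ x ≡ y → ¬ y ≡ v ⟨ x ⟩ → own x ≡ own y → own (v ⟨ x ⟩) ≡ own (v ⟨ y ⟩) → 1 ≤ #doubles v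
  double-witness {v} ok x y x≢y y≢vx same same' = by-side (restricted x)
    where
    open IsRestrictedPairing (restricted?-sound {v} ok)
    vx≢vy : ¬ v ⟨ x ⟩ ≡ v ⟨ y ⟩
    vx≢vy e = x≢y (trans (sym (involutive x)) (trans (cong (v ⟨_⟩) e) (involutive y)))
    x≢vy : ¬ x ≡ v ⟨ y ⟩
    x≢vy e = y≢vx (trans (sym (involutive y)) (cong (v ⟨_⟩) (sym e)))
    by-side : InR x ⊎ InR (v ⟨ x ⟩) → 1 ≤ #doubles v
    by-side (inj₂ vx∈R) =
      Σl-indicators-pos doubleR? (λ cc → restricted? v ∧ contains? (pairsOf cc) v)
        (∈-cartesianProduct⁺ (∈-all-pairs x y) (∈-all-pairs (v ⟨ x ⟩) (v ⟨ y ⟩)))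
        (doubleR-intro same same' (InR-by-vertex (sym same') vx∈R) x≢y vx≢vy x≢vy (λ e → y≢vx (sym e)))
        (∧-intro ok (∧-intro (≡⇒== {x = v ⟨ x ⟩} refl) (∧-intro (≡⇒== {x = v ⟨ y ⟩} refl) refl)))
    by-side (inj₁ x∈R) =
      Σl-indicators-pos doubleR? (λ cc → restricted? v ∧ contains? (pairsOf cc) v)
        (∈-cartesianProduct⁺ (∈-all-pairs (v ⟨ x ⟩) (v ⟨ y ⟩)) (∈-all-pairs x y))
        (doubleR-intro same' same (InR-by-vertex (sym same) x∈R) vx≢vy x≢y (λ e → y≢vx (sym e)) x≢vy)
        (∧-intro ok (∧-intro (≡⇒== (involutive x)) (∧-intro (≡⇒== (involutive y)) refl)))

  double-at-elim : ∀ {v x y} →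
    (not (x == y) ∧ not (y == v ⟨ x ⟩) ∧ (own x == own y) ∧ (own (v ⟨ x ⟩) == own (v ⟨ y ⟩))
      ∧ not (own x == own (v ⟨ x ⟩))) ≡ true →
    ¬ x ≡ y × ¬ y ≡ v ⟨ x ⟩ × own x ≡ own y × own (v ⟨ x ⟩) ≡ own (v ⟨ y ⟩)
  double-at-elim {v} {x} {y} double with ∧-elim {not (x == y)} double
  ... | x≢y , rest with ∧-elim {not (y == v ⟨ x ⟩)} rest
  ... | y≢vx , rest' with ∧-elim {own x == own y} rest'
  ... | same , rest'' = ==⇒≢ (not-elim x≢y) , ==⇒≢ (not-elim y≢vx) , ==⇒≡ same , ==⇒≡ (proj₁ (∧-elim rest''))

  bad⇒configuration : ∀ {v} → bad? v ≡ true → 1 ≤ #loops v + #doubles v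
  bad⇒configuration {v} is-bad with ∧-elim {isPairing d v} is-bad
  ... | pairing , rest with ∧-elim {isRestricted d inL v} rest
  ... | restricted , defect with ∨-elim defect
  ... | inj₁ has-loop with any-elim _ all-points has-loop
  ... | x , _ , loop =
    ≤-trans (loop-witness {v} (∧-intro pairing restricted) x (==⇒≡ loop)) (m≤m+n (#loops v) (#doubles v))
  bad⇒configuration {v} is-bad | pairing , _ | restricted , _ | inj₂ has-double
    with any-elim _ all-points has-double
  ... | x , _ , double-at-x with any-elim _ all-points double-at-x
  ... | y , _ , double with double-at-elim {v} double
  ... | x≢y , y≢vx , same , same' =
    ≤-trans (double-witness {v} (∧-intro pairing restricted) x y x≢y y≢vx same same') (m≤n+m (#doubles v) (#loops v))

  bad-indicator : ∀ v → ⟦ bad? v ⟧ ≤ #loops v + #doubles v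
  bad-indicator v with bad? v in is-bad
  ... | true = bad⇒configuration {v} is-bad
  ... | false = z≤n

  all-pairs² : List ((Pt × Pt) × (Pt × Pt))
  all-pairs² = cartesianProduct all-pairs all-pairs

  loop-mass : ℕ
  loop-mass = Σl (λ c → ⟦ twinsR? c ⟧ * length (containing (c ∷ []))) all-pairs

  double-mass : ℕ
  double-mass = Σl (λ cc → ⟦ doubleR? cc ⟧ * length (containing (pairsOf cc))) all-pairs²

  union-bound : nBad d inL ≤ loop-mass + double-mass
  union-bound = begin
    nBad d inL                                                ≡⟨ length-filterᵇ bad? all-candidates ⟩
    Σl (λ v → ⟦ bad? v ⟧) all-candidates                      ≤⟨ Σl-mono all-candidates bad-indicator ⟩
    Σl (λ v → #loops v + #doubles v) all-candidates           ≡⟨ Σl-+ #loops #doubles all-candidates ⟩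
    Σl #loops all-candidates + Σl #doubles all-candidates
      ≡⟨ cong₂ _+_
           (double-count (λ c → ⟦ twinsR? c ⟧) (λ c v → restricted? v ∧ contains? (c ∷ []) v)
                         all-pairs all-candidates)
           (double-count (λ cc → ⟦ doubleR? cc ⟧) (λ cc v → restricted? v ∧ contains? (pairsOf cc) v)
                         all-pairs² all-candidates) ⟩
    loop-mass + double-mass                                   ∎
    where open ≤-Reasoning

  #twinsR : ℕ
  #twinsR = Σl (λ c → ⟦ twinsR? c ⟧) all-pairs

  #doublesR : ℕ
  #doublesR = Σl (λ cc → ⟦ doubleR? cc ⟧) all-pairs²

  loop-mass-bound : loop-mass * K ≤ #twinsR * nRestricted d inL
  loop-mass-bound = Σl-indicator-bound twinsR? (λ c → length (containing (c ∷ []))) K (nRestricted d inL) all-pairs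
    (λ { (x , x') twins → one-pair-bound x x' (twinsR⇒InR {x} twins) })

  double-mass-bound : double-mass * (K * K) ≤ #doublesR * nRestricted d inL
  double-mass-bound =
    Σl-indicator-bound doubleR? (λ cc → length (containing (pairsOf cc))) (K * K) (nRestricted d inL) all-pairs² bound
    where
    bound : ∀ cc → doubleR? cc ≡ true → length (containing (pairsOf cc)) * (K * K) ≤ nRestricted d inL
    bound ((x , y) , (x' , y')) double with doubleR-elim {x} {y} {x'} {y'} double
    ... | x'∈R , y'∈R , x≢y , x'≢y' , x≢y' , x'≢y =
      ≤-trans (≤-reflexive (sym (*-assoc (length (containing (pairsOf ((x , y) , (x' , y'))))) K K)))
        (two-pair-bound x x' y y' x'∈R y'∈R (x≢y ∘ sym) (x'≢y ∘ sym) (x≢y' ∘ sym) (x'≢y' ∘ sym))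

  twins-or-self : ∀ u w →
    ⟦ twinsR? (u , w) ⟧ + ⟦ u == w ⟧ * ⟦ not (inL (own w)) ⟧ ≤ ⟦ own u == own w ⟧ * ⟦ not (inL (own w)) ⟧
  twins-or-self u w with u F.≟ w
  ... | yes refl rewrite ≡⇒== {x = own u} refl = ≤-refl
  ... | no u≢w = ≤-reflexive (trans (+-identityʳ _) (⟦∧⟧ (own u == own w) _))

  #twins-of : ∀ w → Σl (λ u → ⟦ twinsR? (u , w) ⟧) all-points ≤ ⟦ not (inL (own w)) ⟧ * (d (own w) ∸ 1)
  #twins-of w = subst (Σl (λ u → ⟦ twinsR? (u , w) ⟧) all-points ≤_) ∸-as-product (m+n≤o⇒m≤o∸n _ with-self)
    where
    r : ℕ
    r = ⟦ not (inL (own w)) ⟧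
    with-self : Σl (λ u → ⟦ twinsR? (u , w) ⟧) all-points + r ≤ d (own w) * r
    with-self = begin
      Σl (λ u → ⟦ twinsR? (u , w) ⟧) all-points + r
        ≡⟨ cong (Σl (λ u → ⟦ twinsR? (u , w) ⟧) all-points +_) (sym (Σl-point w (λ _ → r))) ⟩
      Σl (λ u → ⟦ twinsR? (u , w) ⟧) all-points + Σl (λ u → ⟦ u == w ⟧ * r) all-points
        ≡⟨ sym (Σl-+ _ _ all-points) ⟩
      Σl (λ u → ⟦ twinsR? (u , w) ⟧ + ⟦ u == w ⟧ * r) all-points  ≤⟨ Σl-mono all-points (λ u → twins-or-self u w) ⟩
      Σl (λ u → ⟦ own u == own w ⟧ * r) all-points               ≡⟨ Σl-*ʳ r _ all-points ⟩
      Σl (λ u → ⟦ own u == own w ⟧) all-points * r               ≡⟨ cong (_* r) (degree (own w)) ⟩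
      d (own w) * r                                               ∎
      where open ≤-Reasoning
    ∸-as-product : d (own w) * r ∸ r ≡ r * (d (own w) ∸ 1)
    ∸-as-product = trans (cong₂ _∸_ (*-comm (d (own w)) r) (sym (*-identityʳ r))) (sym (*-distribˡ-∸ r (d (own w)) 1))

  #twinsR≤M2R : #twinsR ≤ M2R d inL
  #twinsR≤M2R = begin
    #twinsR                                                           ≡⟨ Σl-cartesianProduct (λ c → ⟦ twinsR? c ⟧) all-points all-points ⟩
    Σl (λ u → Σl (λ w → ⟦ twinsR? (u , w) ⟧) all-points) all-points  ≡⟨ Σl-swap (λ u w → ⟦ twinsR? (u , w) ⟧) all-points all-points ⟩
    Σl (λ w → Σl (λ u → ⟦ twinsR? (u , w) ⟧) all-points) all-points  ≤⟨ Σl-mono all-points #twins-of ⟩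
    Σl (λ w → ⟦ not (inL (own w)) ⟧ * (d (own w) ∸ 1)) all-points    ≡⟨ Σ-points (λ i → ⟦ not (inL i) ⟧ * (d i ∸ 1)) ⟩
    Σl (λ i → d i * (⟦ not (inL i) ⟧ * (d i ∸ 1))) (allFin n)        ≡⟨ M2R-as-sum ⟩
    M2R d inL                                                         ∎
    where open ≤-Reasoning

  #same-vertex : ℕ
  #same-vertex = Σl (λ c → ⟦ own (proj₁ c) == own (proj₂ c) ⟧) all-pairs

  #same-vertex≤ : #same-vertex ≤ dmax d * M d
  #same-vertex≤ = begin
    #same-vertex                                                      ≡⟨ Σl-cartesianProduct _ all-points all-points ⟩
    Σl (λ u → Σl (λ w → ⟦ own u == own w ⟧) all-points) all-points   ≡⟨ Σl-swap (λ u w → ⟦ own u == own w ⟧) all-points all-points ⟩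
    Σl (λ w → Σl (λ u → ⟦ own u == own w ⟧) all-points) all-points   ≡⟨ Σl-cong all-points (λ w → degree (own w)) ⟩
    Σl (λ w → d (own w)) all-points                                   ≡⟨ Σ-points d ⟩
    Σl (λ i → d i * d i) (allFin n)                                   ≤⟨ Σl-mono (allFin n) (λ i → *-monoʳ-≤ (d i) (≤-dmax d i)) ⟩
    Σl (λ i → d i * dmax d) (allFin n)                                ≡⟨ Σl-*ʳ (dmax d) d (allFin n) ⟩
    M d * dmax d                                                      ≡⟨ *-comm (M d) (dmax d) ⟩
    dmax d * M d                                                      ∎
    where open ≤-Reasoning

  -- A double-pair configuration is a pair of points in a common vertex
  -- together with a loop configuration.
  #doublesR≤ : #doublesR ≤ #same-vertex * #twinsR
  #doublesR≤ = begin
    #doublesR                                                         ≤⟨ Σl-mono all-pairs² split ⟩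
    Σl (λ cc → ⟦ own (proj₁ (proj₁ cc)) == own (proj₂ (proj₁ cc)) ⟧ * ⟦ twinsR? (proj₂ cc) ⟧) all-pairs²
                                                                      ≡⟨ Σl-cartesianProduct _ all-pairs all-pairs ⟩
    Σl (λ c → Σl (λ c' → ⟦ own (proj₁ c) == own (proj₂ c) ⟧ * ⟦ twinsR? c' ⟧) all-pairs) all-pairs
                          ≡⟨ Σl-cong all-pairs (λ c → Σl-*ˡ ⟦ own (proj₁ c) == own (proj₂ c) ⟧ (λ c' → ⟦ twinsR? c' ⟧) all-pairs) ⟩
    Σl (λ c → ⟦ own (proj₁ c) == own (proj₂ c) ⟧ * #twinsR) all-pairs ≡⟨ Σl-*ʳ #twinsR _ all-pairs ⟩
    #same-vertex * #twinsR                                            ∎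
    where
    open ≤-Reasoning
    split : ∀ cc → ⟦ doubleR? cc ⟧ ≤ ⟦ own (proj₁ (proj₁ cc)) == own (proj₂ (proj₁ cc)) ⟧ * ⟦ twinsR? (proj₂ cc) ⟧
    split ((x , y) , (x' , y')) with own x == own y | twinsR? (x' , y')
    ... | true | true = ⟦⟧≤1 _
    ... | true | false = z≤n
    ... | false | _ = z≤n

  bad-times-K² : nBad d inL * (K * K) ≤ (1 + dmax d) * M d * M2R d inL * nRestricted d inL
  bad-times-K² = begin
    nBad d inL * (K * K)                                   ≤⟨ *-monoˡ-≤ (K * K) union-bound ⟩
    (loop-mass + double-mass) * (K * K)                    ≡⟨ *-distribʳ-+ (K * K) loop-mass double-mass ⟩
    loop-mass * (K * K) + double-mass * (K * K)            ≤⟨ +-mono-≤ loops doubles ⟩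
    M2R d inL * #restricted * M d + dmax d * M d * M2R d inL * #restricted     ≡⟨ collect (M2R d inL) #restricted (M d) (dmax d) ⟩
    (1 + dmax d) * M d * M2R d inL * #restricted                     ∎
    where
    open ≤-Reasoning
    #restricted : ℕ
    #restricted = nRestricted d inL
    loops : loop-mass * (K * K) ≤ M2R d inL * #restricted * M d
    loops = begin
      loop-mass * (K * K)     ≡⟨ sym (*-assoc loop-mass K K) ⟩
      loop-mass * K * K       ≤⟨ *-mono-≤ (≤-trans loop-mass-bound (*-monoˡ-≤ #restricted #twinsR≤M2R)) K≤M ⟩
      M2R d inL * #restricted * M d     ∎
    doubles : double-mass * (K * K) ≤ dmax d * M d * M2R d inL * #restricted
    doubles = ≤-trans double-mass-bound
      (*-monoˡ-≤ #restricted (≤-trans #doublesR≤ (*-mono-≤ #same-vertex≤ #twinsR≤M2R)))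
    collect : ∀ r t m D → r * t * m + D * m * r * t ≡ (1 + D) * m * r * t
    collect = solve-∀

  -- Under the standing assumption M₁(L) ≤ M₁(R), at least half of the points
  -- lie in R, so M ≤ 4K once M ≥ 16.
  M≤4K : 16 ≤ M d → M1 d inL true ≤ M1R → M d ≤ 4 * K
  M≤4K 16≤M L≤R = subst (M d ≤_) (sym (*-distribˡ-∸ 4 M1R 4)) (m+n≤o⇒m≤o∸n (M d) M+16≤4M1R)
    where
    M+16≤4M1R : M d + 16 ≤ 4 * M1R
    M+16≤4M1R = begin
      M d + 16                    ≤⟨ +-monoʳ-≤ (M d) 16≤M ⟩
      M d + M d                   ≡⟨ sym (cong₂ _+_ M1-split M1-split) ⟩
      (M1 d inL true + M1R) + (M1 d inL true + M1R)
                                  ≤⟨ +-mono-≤ (+-monoˡ-≤ M1R L≤R) (+-monoˡ-≤ M1R L≤R) ⟩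
      (M1R + M1R) + (M1R + M1R)   ≡⟨ four-times M1R ⟩
      4 * M1R                     ∎
      where
      open ≤-Reasoning
      four-times : ∀ x → (x + x) + (x + x) ≡ 4 * x
      four-times = solve-∀

  bad-ratio : 16 ≤ M d → M1 d inL true ≤ M1R →
    nBad d inL * M d ≤ 16 * (1 + dmax d) * M2R d inL * nRestricted d inL
  bad-ratio 16≤M L≤R = *-cancelʳ-≤ (nBad d inL * M d) (16 * (1 + dmax d) * M2R d inL * #restricted) (M d) {{M≢0}} (begin
    nBad d inL * M d * M d                           ≤⟨ *-mono-≤ (*-monoʳ-≤ (nBad d inL) M≤4K′) M≤4K′ ⟩
    nBad d inL * (4 * K) * (4 * K)                   ≡⟨ pull-16 (nBad d inL) K ⟩
    16 * (nBad d inL * (K * K))                      ≤⟨ *-monoʳ-≤ 16 bad-times-K² ⟩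
    16 * ((1 + dmax d) * M d * M2R d inL * #restricted)        ≡⟨ push-M (dmax d) (M d) (M2R d inL) #restricted ⟩
    16 * (1 + dmax d) * M2R d inL * #restricted * M d          ∎)
    where
    open ≤-Reasoning
    #restricted : ℕ
    #restricted = nRestricted d inL
    M≤4K′ : M d ≤ 4 * K
    M≤4K′ = M≤4K 16≤M L≤R
    M≢0 : NonZero (M d)
    M≢0 = >-nonZero (≤-trans (s≤s z≤n) 16≤M)
    pull-16 : ∀ b k → b * (4 * k) * (4 * k) ≡ 16 * (b * (k * k))
    pull-16 = solve-∀
    push-M : ∀ D m r t → 16 * ((1 + D) * m * r * t) ≡ 16 * (1 + D) * r * t * m
    push-M = solve-∀

-- (1 + D) D³ ≤ 2 D⁴: both sides vanish for D = 0, and 1 + D ≤ 2D otherwise.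
one-plus-D-times-cube : ∀ D → (1 + D) * D ^ 3 ≤ 2 * D ^ 4
one-plus-D-times-cube zero = z≤n
one-plus-D-times-cube D@(suc k) = begin
  (1 + D) * D ^ 3   ≤⟨ *-monoˡ-≤ (D ^ 3) (+-monoˡ-≤ D (s≤s (z≤n {k}))) ⟩
  (D + D) * D ^ 3   ≡⟨ double D ⟩
  2 * D ^ 4         ∎
  where
  open ≤-Reasoning
  -- exponents spelled out as products, so that the ring solver can normalise them
  double : ∀ x → (x + x) * (x * (x * (x * 1))) ≡ 2 * (x * (x * (x * (x * 1))))
  double = solve-∀

cubic⇒quartic : ∀ C D r t → r ≤ C * D ^ 3 → 16 * (1 + D) * r * t ≤ 32 * C * D ^ 4 * t
cubic⇒quartic C D r t r≤CD³ = begin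
  16 * (1 + D) * r * t                ≤⟨ *-monoˡ-≤ t (*-monoʳ-≤ (16 * (1 + D)) r≤CD³) ⟩
  16 * (1 + D) * (C * D ^ 3) * t      ≡⟨ regroup C D t ⟩
  16 * C * t * ((1 + D) * D ^ 3)      ≤⟨ *-monoʳ-≤ (16 * C * t) (one-plus-D-times-cube D) ⟩
  16 * C * t * (2 * D ^ 4)            ≡⟨ collect C D t ⟩
  32 * C * D ^ 4 * t                  ∎
  where
  open ≤-Reasoning
  -- exponents spelled out as products, so that the ring solver can normalise them
  regroup : ∀ C D t → 16 * (1 + D) * (C * (D * (D * (D * 1)))) * t ≡ 16 * C * t * ((1 + D) * (D * (D * (D * 1))))
  regroup = solve-∀
  collect : ∀ C D t → 16 * C * t * (2 * (D * (D * (D * (D * 1))))) ≡ 32 * C * (D * (D * (D * (D * 1)))) * t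
  collect = solve-∀

-- Beyond N₀ + N₁ both M ≥ 16 and M₂(R) ≤ C d_max³ hold, so bad-ratio and
-- cubic⇒quartic give the bound with constant 32C.
corollary3p4 : (d : (n : ℕ) → Fin n → ℕ) (inL : (n : ℕ) → Fin n → Bool) →
    (∀ n → 2 ∣ M (d n)) →
    (∀ n → M1 (d n) (inL n) true ≤ M1 (d n) (inL n) false) →
    (∀ B → Σ ℕ λ N → ∀ n → N ≤ n → B ≤ M (d n)) →
    (∀ k → Σ ℕ λ N → ∀ n → N ≤ n → suc k * dmax (d n) ^ 4 ≤ M (d n)) →
    (Σ ℕ λ C → Σ ℕ λ N → ∀ n → N ≤ n → M2R (d n) (inL n) ≤ C * dmax (d n) ^ 3) →
    Σ ℕ λ C → Σ ℕ λ N → ∀ n → N ≤ n →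
      nBad (d n) (inL n) * M (d n) ≤ C * dmax (d n) ^ 4 * nRestricted (d n) (inL n)
corollary3p4 d inL _ L≤R M→∞ _ (C , N₀ , M2R≤CD³) = 32 * C , N₀ + N₁ , bound
  where
  N₁ : ℕ
  N₁ = proj₁ (M→∞ 16)
  bound : ∀ n → N₀ + N₁ ≤ n → nBad (d n) (inL n) * M (d n) ≤ 32 * C * dmax (d n) ^ 4 * nRestricted (d n) (inL n)
  bound n N≤n = ≤-trans
    (Pairings.bad-ratio (d n) (inL n) (proj₂ (M→∞ 16) n (≤-trans (m≤n+m N₁ N₀) N≤n)) (L≤R n))
    (cubic⇒quartic C (dmax (d n)) (M2R (d n) (inL n)) (nRestricted (d n) (inL n))
      (M2R≤CD³ n (≤-trans (m≤m+n N₀ N₁) N≤n)))
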